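{- For all $z \in \mathbb{Z}$, the polynomial \[ f_{z}(X) = X^{4} - zX^{3} - \frac{3z^{6}-16z^{4}+37z^{2}-32}{8} X^{2} - \frac{2z^{9}-19z^{7}+72z^{5}-135z^{3}+96z}{16} X - \frac{3z^{12}-40z^{10}+214z^{8}-576z^{6}+719z^{4}-64z^{2}-512}{256} \] is irreducible in $\mathbb{Q}[X]$. -}

module Defs where

open import Data.Nat as ℕ using (ℕ; zero; suc)
open import Data.Integer as Int using (ℤ; +_)
open import Data.Rational as ℚ using (ℚ; 0ℚ; 1ℚ)
open import Data.List using (List; []; _∷_; map)
open import Data.Product using (Σ; _×_)
open import Data.Sum using (_⊎_)
open import Relation.Binary.PropositionalEquality using (_≡_)
open import Relation.Nullary using (¬_)

-- Univariate polynomials over ℚ, as coefficient lists (constant term first).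
-- Trailing zeros are allowed; equality of polynomials is coefficient-wise.
Poly : Set
Poly = List ℚ

coeff : Poly → ℕ → ℚ
coeff []      _       = 0ℚ
coeff (a ∷ p) zero    = a
coeff (a ∷ p) (suc n) = coeff p n

infix 4 _≈P_
_≈P_ : Poly → Poly → Set
p ≈P q = ∀ n → coeff p n ≡ coeff q n

infixl 6 _+P_
_+P_ : Poly → Poly → Poly
[]      +P q       = q
(a ∷ p) +P []      = a ∷ p
(a ∷ p) +P (b ∷ q) = (a ℚ.+ b) ∷ (p +P q)

infixl 7 _*P_
_*P_ : Poly → Poly → Poly
[]      *P q = []
(a ∷ p) *P q = map (a ℚ.*_) q +P (0ℚ ∷ (p *P q))

zeroP oneP : Poly
zeroP = []
oneP  = 1ℚ ∷ []

IsUnit : Poly → Set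
IsUnit g = Σ Poly λ h → g *P h ≈P oneP

Irreducible : Poly → Set
Irreducible f =
  ¬ (f ≈P zeroP) × ¬ IsUnit f ×
  (∀ g h → f ≈P g *P h → IsUnit g ⊎ IsUnit h)

f : ℤ → Poly
f z = c0 ∷ c1 ∷ c2 ∷ c3 ∷ 1ℚ ∷ []
  where
  open Int using (_+_; _-_; _*_; _^_)
  n2 n1 n0 : ℤ
  n2 = + 3 * z ^ 6 - + 16 * z ^ 4 + + 37 * z ^ 2 - + 32
  n1 = + 2 * z ^ 9 - + 19 * z ^ 7 + + 72 * z ^ 5 - + 135 * z ^ 3 + + 96 * z
  n0 = + 3 * z ^ 12 - + 40 * z ^ 10 + + 214 * z ^ 8 - + 576 * z ^ 6
       + + 719 * z ^ 4 - + 64 * z ^ 2 - + 512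
  c3 c2 c1 c0 : ℚ
  c3 = ℚ.- (z ℚ./ 1)
  c2 = ℚ.- (n2 ℚ./ 8)
  c1 = ℚ.- (n1 ℚ./ 16)
  c0 = ℚ.- (n0 ℚ./ 256)

-- Clearing denominators turns a factorisation f_z = g h in ℚ[X] with deg g, deg h ≥ 1 into
-- integer polynomials P, Q of the same degrees and an integer M ≠ 0 with 256 (P Q) = M F_z,
-- where F_z = 256 f_z has integer coefficients and leading coefficient 256 ≡ 1 (mod 3).
-- For every residue of z, F_z is irreducible over F₃ (a finite computation), so M must be
-- divisible by 3: otherwise P Q reduces to a nonzero multiple of F_z.  Then P Q ≡ 0 (mod 3),
-- so 3 divides P or Q because F₃[X] is a domain; dividing it out and comparing leading
-- coefficients produces a factorisation with M / 3 in place of M.  Descent on ∣M∣ is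
-- impossible, so one of g, h is constant, i.e. a unit.
module Submission where

open import Defs
open import Data.Integer using (ℤ)

open import Function using (_∘_)
open import Data.Nat as ℕ using (ℕ; zero; suc; z≤n; s≤s)
import Data.Nat.Properties as ℕP
open import Data.Nat.Induction using (<-wellFounded)
open import Data.Integer as ℤ using (+_; -[1+_]; _◃_; _⊖_)
import Data.Integer.Properties as ℤP
open import Data.Sign as Sign using (Sign)
open import Data.Rational as ℚ using (ℚ; 0ℚ; 1ℚ; ↥_; ↧_; ↧ₙ_; toℚᵘ)
import Data.Rational.Properties as ℚP
open import Data.Rational.Unnormalised using (mkℚᵘ; *≡*) renaming (_≃_ to _≃ᵘ_)
import Data.Rational.Unnormalised.Properties as ℚᵘP
open import Data.Fin using (Fin; toℕ)
open import Data.Fin.Properties using (all?)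
open import Data.Vec using (Vec; []; _∷_; tabulate)
open import Data.List using ([]; _∷_; map; length)
open import Data.Product using (Σ; ∃; ∃₂; _×_; _,_; proj₁; proj₂)
open import Data.Sum using (_⊎_; inj₁; inj₂; [_,_]′)
open import Data.Empty using (⊥; ⊥-elim)
open import Relation.Nullary
  using (¬_; Dec; yes; no; map′; ¬?; _×-dec_; _⊎-dec_; _→-dec_; from-yes; contradiction)
open import Relation.Unary using (Decidable)
open import Relation.Binary.Definitions using (DecidableEquality; tri<; tri≈; tri>)
open import Relation.Binary.PropositionalEquality
  using (_≡_; _≢_; refl; sym; trans; cong; cong₂; subst; isEquivalence; module ≡-Reasoning)
open import Induction.WellFounded using (Acc; acc)
open import Algebra.Bundles using (CommutativeRing)
import Algebra.Properties.CommutativeSemigroup as CommutativeSemigroupProperties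

module ℤ* = CommutativeSemigroupProperties ℤP.*-commutativeSemigroup
module ℚ* = CommutativeSemigroupProperties
  (CommutativeRing.*-commutativeSemigroup ℚP.+-*-commutativeRing)

-- Polynomials as coefficient sequences

module Convolution {c ℓ} (R : CommutativeRing c ℓ) where
  open CommutativeRing R renaming (refl to ≈-refl; sym to ≈-sym; trans to ≈-trans)
  open CommutativeSemigroupProperties *-commutativeSemigroup using (x∙yz≈y∙xz)
  open import Relation.Binary.Reasoning.Setoid setoid

  infixl 7 _⋆_
  infix 4 _HasDegree≤_

  -- (a ⋆ b) k = Σ_{i+j=k} a i * b j, peeling off i = 0
  _⋆_ : (ℕ → Carrier) → (ℕ → Carrier) → ℕ → Carrier
  (a ⋆ b) zero    = a 0 * b 0
  (a ⋆ b) (suc k) = a 0 * b (suc k) + (a ∘ suc ⋆ b) k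

  _HasDegree≤_ : (ℕ → Carrier) → ℕ → Set ℓ
  a HasDegree≤ m = ∀ i → m ℕ.< i → a i ≈ 0#

  ⋆-cong : ∀ {a a′ b b′} → (∀ i → a i ≈ a′ i) → (∀ j → b j ≈ b′ j) →
           ∀ k → (a ⋆ b) k ≈ (a′ ⋆ b′) k
  ⋆-cong a≈ b≈ zero    = *-cong (a≈ 0) (b≈ 0)
  ⋆-cong a≈ b≈ (suc k) = +-cong (*-cong (a≈ 0) (b≈ (suc k))) (⋆-cong (a≈ ∘ suc) b≈ k)

  ⋆-zeroˡ : ∀ {a} b → (∀ i → a i ≈ 0#) → ∀ k → (a ⋆ b) k ≈ 0#
  ⋆-zeroˡ b a≈0 zero    = ≈-trans (*-congʳ (a≈0 0)) (zeroˡ _)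
  ⋆-zeroˡ b a≈0 (suc k) = begin
    _ ≈⟨ +-cong (*-congʳ (a≈0 0)) (⋆-zeroˡ b (a≈0 ∘ suc) k) ⟩
    0# * _ + 0#  ≈⟨ +-identityʳ _ ⟩
    0# * _       ≈⟨ zeroˡ _ ⟩
    0#           ∎

  ⋆-zeroʳ : ∀ a {b} → (∀ j → b j ≈ 0#) → ∀ k → (a ⋆ b) k ≈ 0#
  ⋆-zeroʳ a b≈0 zero    = ≈-trans (*-congˡ (b≈0 0)) (zeroʳ _)
  ⋆-zeroʳ a b≈0 (suc k) = begin
    _ ≈⟨ +-cong (*-congˡ (b≈0 (suc k))) (⋆-zeroʳ (a ∘ suc) b≈0 k) ⟩
    a 0 * 0# + 0#  ≈⟨ +-identityʳ _ ⟩
    a 0 * 0#       ≈⟨ zeroʳ _ ⟩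
    0#             ∎

  ⋆-scaleˡ : ∀ x a b k → ((λ i → x * a i) ⋆ b) k ≈ x * (a ⋆ b) k
  ⋆-scaleˡ x a b zero    = *-assoc _ _ _
  ⋆-scaleˡ x a b (suc k) = begin
    x * a 0 * b (suc k) + ((λ i → x * a (suc i)) ⋆ b) k
      ≈⟨ +-cong (*-assoc _ _ _) (⋆-scaleˡ x (a ∘ suc) b k) ⟩
    x * (a 0 * b (suc k)) + x * (a ∘ suc ⋆ b) k
      ≈⟨ distribˡ _ _ _ ⟨
    x * (a ⋆ b) (suc k) ∎

  ⋆-scaleʳ : ∀ x a b k → (a ⋆ (λ j → x * b j)) k ≈ x * (a ⋆ b) k
  ⋆-scaleʳ x a b zero    = x∙yz≈y∙xz _ _ _
  ⋆-scaleʳ x a b (suc k) = begin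
    a 0 * (x * b (suc k)) + (a ∘ suc ⋆ (λ j → x * b j)) k
      ≈⟨ +-cong (x∙yz≈y∙xz _ _ _) (⋆-scaleʳ x (a ∘ suc) b k) ⟩
    x * (a 0 * b (suc k)) + x * (a ∘ suc ⋆ b) k
      ≈⟨ distribˡ _ _ _ ⟨
    x * (a ⋆ b) (suc k) ∎

  ⋆-constˡ : ∀ {a} b → a HasDegree≤ 0 → ∀ k → (a ⋆ b) k ≈ a 0 * b k
  ⋆-constˡ b a≤0 zero    = ≈-refl
  ⋆-constˡ b a≤0 (suc k) =
    ≈-trans (+-congˡ (⋆-zeroˡ b (λ i → a≤0 (suc i) (s≤s z≤n)) k)) (+-identityʳ _)

  ⋆-leading : ∀ m n {a b} → a HasDegree≤ m → b HasDegree≤ n →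
              (a ⋆ b) (m ℕ.+ n) ≈ a m * b n
  ⋆-leading zero    n a≤m b≤n = ⋆-constˡ _ a≤m n
  ⋆-leading (suc m) n {a} {b} a≤m b≤n = begin
    a 0 * b (suc (m ℕ.+ n)) + (a ∘ suc ⋆ b) (m ℕ.+ n)
      ≈⟨ +-cong (*-congˡ (b≤n _ (s≤s (ℕP.m≤n+m n m))))
                (⋆-leading m n (λ i → a≤m (suc i) ∘ s≤s) b≤n) ⟩
    a 0 * 0# + a (suc m) * b n  ≈⟨ +-congʳ (zeroʳ _) ⟩
    0# + a (suc m) * b n        ≈⟨ +-identityˡ _ ⟩
    a (suc m) * b n             ∎

  ⋆-degree≤ : ∀ m n {a b} → a HasDegree≤ m → b HasDegree≤ n → (a ⋆ b) HasDegree≤ (m ℕ.+ n)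
  ⋆-degree≤ zero n {a} a≤m b≤n k n<k = begin
    (a ⋆ _) k  ≈⟨ ⋆-constˡ _ a≤m k ⟩
    a 0 * _    ≈⟨ *-congˡ (b≤n k n<k) ⟩
    a 0 * 0#   ≈⟨ zeroʳ _ ⟩
    0#         ∎
  ⋆-degree≤ (suc m) n {a} {b} a≤m b≤n (suc k) (s≤s m+n<k) = begin
    a 0 * b (suc k) + (a ∘ suc ⋆ b) k
      ≈⟨ +-cong (*-congˡ (b≤n (suc k) (s≤s (ℕP.≤-trans (ℕP.m≤n+m n m) (ℕP.<⇒≤ m+n<k)))))
                (⋆-degree≤ m n (λ i → a≤m (suc i) ∘ s≤s) b≤n k m+n<k) ⟩
    a 0 * 0# + 0#  ≈⟨ +-identityʳ _ ⟩
    a 0 * 0#       ≈⟨ zeroʳ _ ⟩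
    0#             ∎

  module Domain (_≈0? : ∀ x → Dec (x ≈ 0#))
                (zero-product : ∀ {x y} → x * y ≈ 0# → x ≈ 0# ⊎ y ≈ 0#) where

    infix 4 _HasDegree_
    _HasDegree_ : (ℕ → Carrier) → ℕ → Set ℓ
    a HasDegree d = ¬ a d ≈ 0# × a HasDegree≤ d

    degree : ∀ m {a} → a HasDegree≤ m → (∀ i → a i ≈ 0#) ⊎ ∃ (a HasDegree_)
    degree m {a} a≤m with a m ≈0?
    ... | no am≉0 = inj₂ (m , am≉0 , a≤m)
    degree zero    a≤0 | yes a0≈0 = inj₁ λ { zero → a0≈0 ; (suc i) → a≤0 (suc i) (s≤s z≤n) }
    degree (suc m) a≤m | yes am≈0 = degree m λ i m<i →
      [ a≤m i , (λ { refl → am≈0 }) ]′ (ℕP.m≤n⇒m<n∨m≡n m<i)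

    degree-unique : ∀ {a d e} → a HasDegree d → a HasDegree e → d ≡ e
    degree-unique {d = d} {e} (ad≉0 , a≤d) (ae≉0 , a≤e) with ℕP.<-cmp d e
    ... | tri< d<e _ _ = contradiction (a≤d e d<e) ae≉0
    ... | tri≈ _ d≡e _ = d≡e
    ... | tri> _ _ e<d = contradiction (a≤e d e<d) ad≉0

    degree-cong : ∀ {a b d} → (∀ i → a i ≈ b i) → a HasDegree d → b HasDegree d
    degree-cong a≈b (ad≉0 , a≤d) =
      (λ bd≈0 → ad≉0 (≈-trans (a≈b _) bd≈0)) , λ i d<i → ≈-trans (≈-sym (a≈b i)) (a≤d i d<i)

    ⋆-degree : ∀ {a b d e} → a HasDegree d → b HasDegree e → (a ⋆ b) HasDegree (d ℕ.+ e)
    ⋆-degree {d = d} {e} (ad≉0 , a≤d) (be≉0 , b≤e) =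
      (λ ab≈0 → [ ad≉0 , be≉0 ]′ (zero-product (≈-trans (≈-sym (⋆-leading d e a≤d b≤e)) ab≈0))) ,
      ⋆-degree≤ d e a≤d b≤e

    ⋆-zero-product : ∀ m n {a b} → a HasDegree≤ m → b HasDegree≤ n → (∀ k → (a ⋆ b) k ≈ 0#) →
                     (∀ i → a i ≈ 0#) ⊎ (∀ j → b j ≈ 0#)
    ⋆-zero-product m n a≤m b≤n ab≈0 with degree m a≤m | degree n b≤n
    ... | inj₁ a≈0       | _              = inj₁ a≈0
    ... | inj₂ _         | inj₁ b≈0       = inj₂ b≈0
    ... | inj₂ (d , a∶d) | inj₂ (e , b∶e) =
      contradiction (ab≈0 (d ℕ.+ e)) (proj₁ (⋆-degree a∶d b∶e))

    ⋆-factor-degrees : ∀ m n {a b c t} → a HasDegree≤ m → b HasDegree≤ n → c HasDegree t →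
                       (∀ k → c k ≈ (a ⋆ b) k) →
                       a HasDegree 0 ⊎ b HasDegree 0 ⊎
                       ∃₂ λ d e → a HasDegree suc d × b HasDegree suc e × suc d ℕ.+ suc e ≡ t
    ⋆-factor-degrees m n {a} {b} {t = t} a≤m b≤n c∶t c≈ab with degree m a≤m | degree n b≤n
    ... | inj₁ a≈0           | _                  =
      contradiction (≈-trans (c≈ab t) (⋆-zeroˡ b a≈0 t)) (proj₁ c∶t)
    ... | inj₂ _             | inj₁ b≈0           =
      contradiction (≈-trans (c≈ab t) (⋆-zeroʳ a b≈0 t)) (proj₁ c∶t)
    ... | inj₂ (zero , a∶0)  | inj₂ _             = inj₁ a∶0
    ... | inj₂ (suc _ , _)   | inj₂ (zero , b∶0)  = inj₂ (inj₁ b∶0)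
    ... | inj₂ (suc d , a∶d) | inj₂ (suc e , b∶e) = inj₂ (inj₂ (d , e , a∶d , b∶e ,
      degree-unique (degree-cong (≈-sym ∘ c≈ab) (⋆-degree a∶d b∶e)) c∶t))

module ⋆-Homomorphism {c₁ ℓ₁ c₂ ℓ₂} (R : CommutativeRing c₁ ℓ₁) (S : CommutativeRing c₂ ℓ₂) where
  private
    module R = CommutativeRing R
    module S = CommutativeRing S
  open Convolution R using () renaming (_⋆_ to _⋆ᴿ_)
  open Convolution S using () renaming (_⋆_ to _⋆ˢ_)

  ⋆-homo : (h : R.Carrier → S.Carrier) →
           (∀ x y → h (x R.+ y) S.≈ h x S.+ h y) → (∀ x y → h (x R.* y) S.≈ h x S.* h y) →
           ∀ a b k → h ((a ⋆ᴿ b) k) S.≈ ((h ∘ a) ⋆ˢ (h ∘ b)) k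
  ⋆-homo h h-+ h-* a b zero    = h-* (a 0) (b 0)
  ⋆-homo h h-+ h-* a b (suc k) =
    S.trans (h-+ _ _) (S.+-cong (h-* _ _) (⋆-homo h h-+ h-* (a ∘ suc) b k))

-- The field F₃ and reduction modulo 3

data F₃ : Set where
  0₃ 1₃ 2₃ : F₃

infixl 6 _+₃_
infixl 7 _*₃_
infix  8 -₃_
infix  4 _≟₃_

_+₃_ : F₃ → F₃ → F₃
0₃ +₃ y  = y
x  +₃ 0₃ = x
1₃ +₃ 1₃ = 2₃
1₃ +₃ 2₃ = 0₃
2₃ +₃ 1₃ = 0₃
2₃ +₃ 2₃ = 1₃

-₃_ : F₃ → F₃
-₃ 0₃ = 0₃
-₃ 1₃ = 2₃
-₃ 2₃ = 1₃

_*₃_ : F₃ → F₃ → F₃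
0₃ *₃ y = 0₃
1₃ *₃ y = y
2₃ *₃ y = -₃ y

_≟₃_ : DecidableEquality F₃
0₃ ≟₃ 0₃ = yes refl
0₃ ≟₃ 1₃ = no λ ()
0₃ ≟₃ 2₃ = no λ ()
1₃ ≟₃ 0₃ = no λ ()
1₃ ≟₃ 1₃ = yes refl
1₃ ≟₃ 2₃ = no λ ()
2₃ ≟₃ 0₃ = no λ ()
2₃ ≟₃ 1₃ = no λ ()
2₃ ≟₃ 2₃ = yes refl

all₃? : ∀ {p} {P : F₃ → Set p} → Decidable P → Dec (∀ x → P x)
all₃? P? = map′ (λ (p₀ , p₁ , p₂) → λ { 0₃ → p₀ ; 1₃ → p₁ ; 2₃ → p₂ })
                (λ ∀P → ∀P 0₃ , ∀P 1₃ , ∀P 2₃)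
                (P? 0₃ ×-dec P? 1₃ ×-dec P? 2₃)

module _ where
  open import Algebra.Definitions {A = F₃} _≡_
  open import Algebra.Structures {A = F₃} _≡_

  +₃-assoc : Associative _+₃_
  +₃-assoc = from-yes (all₃? λ x → all₃? λ y → all₃? λ z → (x +₃ y) +₃ z ≟₃ x +₃ (y +₃ z))

  +₃-comm : Commutative _+₃_
  +₃-comm = from-yes (all₃? λ x → all₃? λ y → x +₃ y ≟₃ y +₃ x)

  +₃-identityʳ : RightIdentity 0₃ _+₃_
  +₃-identityʳ = from-yes (all₃? λ x → x +₃ 0₃ ≟₃ x)

  -₃-inverseˡ : LeftInverse 0₃ -₃_ _+₃_
  -₃-inverseˡ = from-yes (all₃? λ x → -₃ x +₃ x ≟₃ 0₃)

  -₃-inverseʳ : RightInverse 0₃ -₃_ _+₃_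
  -₃-inverseʳ = from-yes (all₃? λ x → x +₃ -₃ x ≟₃ 0₃)

  *₃-assoc : Associative _*₃_
  *₃-assoc = from-yes (all₃? λ x → all₃? λ y → all₃? λ z → (x *₃ y) *₃ z ≟₃ x *₃ (y *₃ z))

  *₃-comm : Commutative _*₃_
  *₃-comm = from-yes (all₃? λ x → all₃? λ y → x *₃ y ≟₃ y *₃ x)

  *₃-identityʳ : RightIdentity 1₃ _*₃_
  *₃-identityʳ = from-yes (all₃? λ x → x *₃ 1₃ ≟₃ x)

  *₃-distribˡ-+₃ : _*₃_ DistributesOverˡ _+₃_
  *₃-distribˡ-+₃ = from-yes (all₃? λ x → all₃? λ y → all₃? λ z →
    x *₃ (y +₃ z) ≟₃ x *₃ y +₃ x *₃ z)

  *₃-distribʳ-+₃ : _*₃_ DistributesOverʳ _+₃_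
  *₃-distribʳ-+₃ = from-yes (all₃? λ x → all₃? λ y → all₃? λ z →
    (y +₃ z) *₃ x ≟₃ y *₃ x +₃ z *₃ x)

  +₃-*₃-isCommutativeRing : IsCommutativeRing _+₃_ _*₃_ -₃_ 0₃ 1₃
  +₃-*₃-isCommutativeRing = record
    { isRing = record
      { +-isAbelianGroup = record
        { isGroup = record
          { isMonoid = record
            { isSemigroup = record
              { isMagma = record { isEquivalence = isEquivalence ; ∙-cong = cong₂ _+₃_ }
              ; assoc = +₃-assoc
              }
            ; identity = (λ _ → refl) , +₃-identityʳ
            }
          ; inverse = -₃-inverseˡ , -₃-inverseʳ
          ; ⁻¹-cong = cong -₃_
          }
        ; comm = +₃-comm
        }
      ; *-cong = cong₂ _*₃_
      ; *-assoc = *₃-assoc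
      ; *-identity = (λ _ → refl) , *₃-identityʳ
      ; distrib = *₃-distribˡ-+₃ , *₃-distribʳ-+₃
      }
    ; *-comm = *₃-comm
    }

+₃-*₃-commutativeRing : CommutativeRing _ _
+₃-*₃-commutativeRing = record { isCommutativeRing = +₃-*₃-isCommutativeRing }

open CommutativeRing +₃-*₃-commutativeRing public using () renaming (zeroʳ to *₃-zeroʳ)

*₃-zero-product : ∀ x y → x *₃ y ≡ 0₃ → x ≡ 0₃ ⊎ y ≡ 0₃
*₃-zero-product = from-yes (all₃? λ x → all₃? λ y →
  (x *₃ y ≟₃ 0₃) →-dec (x ≟₃ 0₃ ⊎-dec y ≟₃ 0₃))

infixr 8 _^₃_
_^₃_ : F₃ → ℕ → F₃
x ^₃ zero  = 1₃
x ^₃ suc n = x *₃ x ^₃ n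

φℕ : ℕ → F₃
φℕ zero    = 0₃
φℕ (suc n) = 1₃ +₃ φℕ n

φ : ℤ → F₃
φ (+ n)      = φℕ n
φ (-[1+ n ]) = -₃ φℕ (suc n)

φℕ-+ : ∀ m n → φℕ (m ℕ.+ n) ≡ φℕ m +₃ φℕ n
φℕ-+ zero    n = refl
φℕ-+ (suc m) n = trans (cong (1₃ +₃_) (φℕ-+ m n)) (sym (+₃-assoc 1₃ (φℕ m) (φℕ n)))

φℕ-* : ∀ m n → φℕ (m ℕ.* n) ≡ φℕ m *₃ φℕ n
φℕ-* zero    n = refl
φℕ-* (suc m) n = begin
  φℕ (n ℕ.+ m ℕ.* n)     ≡⟨ φℕ-+ n (m ℕ.* n) ⟩
  φℕ n +₃ φℕ (m ℕ.* n)   ≡⟨ cong (φℕ n +₃_) (φℕ-* m n) ⟩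
  φℕ n +₃ φℕ m *₃ φℕ n   ≡⟨ *₃-distribʳ-+₃ (φℕ n) 1₃ (φℕ m) ⟨
  (1₃ +₃ φℕ m) *₃ φℕ n   ∎
  where open ≡-Reasoning

φ-⊖ : ∀ m n → φ (m ⊖ n) ≡ φℕ m +₃ -₃ φℕ n
φ-⊖ m       zero    = sym (+₃-identityʳ (φℕ m))
φ-⊖ zero    (suc n) = refl
φ-⊖ (suc m) (suc n) = begin
  φ (suc m ⊖ suc n)                  ≡⟨ cong φ (ℤP.[1+m]⊖[1+n]≡m⊖n m n) ⟩
  φ (m ⊖ n)                          ≡⟨ φ-⊖ m n ⟩
  φℕ m +₃ -₃ φℕ n                    ≡⟨ [1+x]-[1+y]≡x-y (φℕ m) (φℕ n) ⟨
  (1₃ +₃ φℕ m) +₃ -₃ (1₃ +₃ φℕ n)    ∎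
  where
  open ≡-Reasoning
  [1+x]-[1+y]≡x-y : ∀ x y → (1₃ +₃ x) +₃ -₃ (1₃ +₃ y) ≡ x +₃ -₃ y
  [1+x]-[1+y]≡x-y = from-yes (all₃? λ x → all₃? λ y → (1₃ +₃ x) +₃ -₃ (1₃ +₃ y) ≟₃ x +₃ -₃ y)

φ-+ : ∀ i j → φ (i ℤ.+ j) ≡ φ i +₃ φ j
φ-+ (+ m)      (+ n)      = φℕ-+ m n
φ-+ (+ m)      (-[1+ n ]) = φ-⊖ m (suc n)
φ-+ (-[1+ m ]) (+ n)      = trans (φ-⊖ n (suc m)) (+₃-comm (φℕ n) _)
φ-+ (-[1+ m ]) (-[1+ n ]) =
  trans (cong (λ x → -₃ (1₃ +₃ (1₃ +₃ x))) (φℕ-+ m n)) (-[2+x+y] (φℕ m) (φℕ n))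
  where
  -[2+x+y] : ∀ x y → -₃ (1₃ +₃ (1₃ +₃ (x +₃ y))) ≡ -₃ (1₃ +₃ x) +₃ -₃ (1₃ +₃ y)
  -[2+x+y] = from-yes (all₃? λ x → all₃? λ y →
    -₃ (1₃ +₃ (1₃ +₃ (x +₃ y))) ≟₃ -₃ (1₃ +₃ x) +₃ -₃ (1₃ +₃ y))

φ-neg : ∀ i → φ (ℤ.- i) ≡ -₃ φ i
φ-neg (+ zero)   = refl
φ-neg (+ suc n)  = refl
φ-neg (-[1+ n ]) = sym (-₃-involutive (φℕ (suc n)))
  where
  -₃-involutive : ∀ x → -₃ -₃ x ≡ x
  -₃-involutive = from-yes (all₃? λ x → -₃ -₃ x ≟₃ x)

σ : Sign → F₃
σ Sign.+ = 1₃
σ Sign.- = 2₃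

σ-* : ∀ s t → σ (s Sign.* t) ≡ σ s *₃ σ t
σ-* Sign.+ t      = refl
σ-* Sign.- Sign.+ = refl
σ-* Sign.- Sign.- = refl

φ-◃ : ∀ s n → φ (s ◃ n) ≡ σ s *₃ φℕ n
φ-◃ Sign.+ zero    = refl
φ-◃ Sign.- zero    = refl
φ-◃ Sign.+ (suc n) = refl
φ-◃ Sign.- (suc n) = refl

φ-* : ∀ i j → φ (i ℤ.* j) ≡ φ i *₃ φ j
φ-* i j = begin
  φ (ℤ.sign i Sign.* ℤ.sign j ◃ ℤ.∣ i ∣ ℕ.* ℤ.∣ j ∣)
    ≡⟨ φ-◃ (ℤ.sign i Sign.* ℤ.sign j) (ℤ.∣ i ∣ ℕ.* ℤ.∣ j ∣) ⟩
  σ (ℤ.sign i Sign.* ℤ.sign j) *₃ φℕ (ℤ.∣ i ∣ ℕ.* ℤ.∣ j ∣)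
    ≡⟨ cong₂ _*₃_ (σ-* (ℤ.sign i) (ℤ.sign j)) (φℕ-* ℤ.∣ i ∣ ℤ.∣ j ∣) ⟩
  (σ (ℤ.sign i) *₃ σ (ℤ.sign j)) *₃ (φℕ ℤ.∣ i ∣ *₃ φℕ ℤ.∣ j ∣)
    ≡⟨ interchange (σ (ℤ.sign i)) (σ (ℤ.sign j)) _ _ ⟩
  (σ (ℤ.sign i) *₃ φℕ ℤ.∣ i ∣) *₃ (σ (ℤ.sign j) *₃ φℕ ℤ.∣ j ∣)
    ≡⟨ cong₂ _*₃_ (sign-abs i) (sign-abs j) ⟨
  φ i *₃ φ j ∎
  where
  open ≡-Reasoning
  open CommutativeSemigroupProperties
    (CommutativeRing.*-commutativeSemigroup +₃-*₃-commutativeRing) using (interchange)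
  sign-abs : ∀ i → φ i ≡ σ (ℤ.sign i) *₃ φℕ ℤ.∣ i ∣
  sign-abs i = trans (cong φ (sym (ℤP.◃-inverse i))) (φ-◃ (ℤ.sign i) ℤ.∣ i ∣)

φ-^ : ∀ i n → φ (i ℤ.^ n) ≡ φ i ^₃ n
φ-^ i zero    = refl
φ-^ i (suc n) = trans (φ-* i (i ℤ.^ n)) (cong (φ i *₃_) (φ-^ i n))

φℕ-kernel : ∀ n → φℕ n ≡ 0₃ → Σ ℕ λ q → n ≡ 3 ℕ.* q
φℕ-kernel zero                _    = 0 , refl
φℕ-kernel (suc zero)          ()
φℕ-kernel (suc (suc zero))    ()
φℕ-kernel (suc (suc (suc n))) φn≡0 =
  let q , n≡3q = φℕ-kernel n (trans (sym (1+1+1+x≡x (φℕ n))) φn≡0)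
  in suc q , trans (cong (3 ℕ.+_) n≡3q) (sym (ℕP.*-suc 3 q))
  where
  1+1+1+x≡x : ∀ x → 1₃ +₃ (1₃ +₃ (1₃ +₃ x)) ≡ x
  1+1+1+x≡x = from-yes (all₃? λ x → 1₃ +₃ (1₃ +₃ (1₃ +₃ x)) ≟₃ x)

φ-kernel : ∀ i → φ i ≡ 0₃ → Σ ℤ λ q → i ≡ + 3 ℤ.* q
φ-kernel (+ n) φn≡0 =
  let q , n≡3q = φℕ-kernel n φn≡0
  in + q , trans (cong +_ n≡3q) (ℤP.pos-* 3 q)
φ-kernel -[1+ n ] φi≡0 =
  let q , 1+n≡3q = φℕ-kernel (suc n) (-x≡0⇒x≡0 (φℕ (suc n)) φi≡0)
  in ℤ.- + q , (begin
    ℤ.- + suc n       ≡⟨ cong (λ k → ℤ.- + k) 1+n≡3q ⟩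
    ℤ.- + (3 ℕ.* q)   ≡⟨ cong ℤ.-_ (ℤP.pos-* 3 q) ⟩
    ℤ.- (+ 3 ℤ.* + q) ≡⟨ ℤP.neg-distribʳ-* (+ 3) (+ q) ⟩
    + 3 ℤ.* ℤ.- + q   ∎)
  where
  open ≡-Reasoning
  -x≡0⇒x≡0 : ∀ x → -₃ x ≡ 0₃ → x ≡ 0₃
  -x≡0⇒x≡0 = from-yes (all₃? λ x → (-₃ x ≟₃ 0₃) →-dec (x ≟₃ 0₃))

ι : ℤ → ℚ
ι i = i ℚ./ 1

-- i ℚ./ suc d is by definition the normalisation fromℚᵘ (mkℚᵘ i d)
toℚᵘ-/ : ∀ i d → toℚᵘ (i ℚ./ suc d) ≃ᵘ mkℚᵘ i d
toℚᵘ-/ i d = ℚP.toℚᵘ-fromℚᵘ (mkℚᵘ i d)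

≡-via-ℚᵘ : ∀ {x y p q} → toℚᵘ x ≃ᵘ p → toℚᵘ y ≃ᵘ q → p ≃ᵘ q → x ≡ y
≡-via-ℚᵘ x≃p y≃q p≃q = ℚP.toℚᵘ-injective (ℚᵘP.≃-trans x≃p (ℚᵘP.≃-trans p≃q (ℚᵘP.≃-sym y≃q)))

ι-+ : ∀ i j → ι (i ℤ.+ j) ≡ ι i ℚ.+ ι j
ι-+ i j = ≡-via-ℚᵘ (toℚᵘ-/ (i ℤ.+ j) 0)
  (ℚᵘP.≃-trans (ℚP.toℚᵘ-homo-+ (ι i) (ι j)) (ℚᵘP.+-cong (toℚᵘ-/ i 0) (toℚᵘ-/ j 0)))
  (*≡* (cong (ℤ._* + 1) (sym (cong₂ ℤ._+_ (ℤP.*-identityʳ i) (ℤP.*-identityʳ j)))))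

ι-* : ∀ i j → ι (i ℤ.* j) ≡ ι i ℚ.* ι j
ι-* i j = ≡-via-ℚᵘ (toℚᵘ-/ (i ℤ.* j) 0)
  (ℚᵘP.≃-trans (ℚP.toℚᵘ-homo-* (ι i) (ι j)) (ℚᵘP.*-cong (toℚᵘ-/ i 0) (toℚᵘ-/ j 0)))
  ℚᵘP.≃-refl

ι-neg : ∀ i → ι (ℤ.- i) ≡ ℚ.- ι i
ι-neg i = ≡-via-ℚᵘ (toℚᵘ-/ (ℤ.- i) 0)
  (ℚᵘP.≃-trans (ℚP.toℚᵘ-homo‿- (ι i)) (ℚᵘP.-‿cong (toℚᵘ-/ i 0)))
  ℚᵘP.≃-refl

ι-injective : ∀ {i j} → ι i ≡ ι j → i ≡ j
ι-injective {i} {j} ιi≡ιj with ℚᵘP.≃-trans (ℚᵘP.≃-sym (toℚᵘ-/ i 0))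
                                  (ℚᵘP.≃-trans (ℚP.toℚᵘ-cong ιi≡ιj) (toℚᵘ-/ j 0))
... | *≡* i*1≡j*1 = trans (sym (ℤP.*-identityʳ i)) (trans i*1≡j*1 (ℤP.*-identityʳ j))

ι-/ : ∀ a d .{{_ : ℕ.NonZero d}} → ι (+ d) ℚ.* (a ℚ./ d) ≡ ι a
ι-/ a (suc d) = ≡-via-ℚᵘ
  (ℚᵘP.≃-trans (ℚP.toℚᵘ-homo-* (ι (+ suc d)) (a ℚ./ suc d))
               (ℚᵘP.*-cong (toℚᵘ-/ (+ suc d) 0) (toℚᵘ-/ a d)))
  (toℚᵘ-/ a 0)
  (*≡* (begin
    + suc d ℤ.* a ℤ.* + 1     ≡⟨ ℤP.*-identityʳ _ ⟩
    + suc d ℤ.* a             ≡⟨ ℤP.*-comm (+ suc d) a ⟩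
    a ℤ.* + suc d             ≡⟨ cong (λ k → a ℤ.* + k) (ℕP.*-identityˡ (suc d)) ⟨
    a ℤ.* + (1 ℕ.* suc d)     ∎))
  where open ≡-Reasoning

ι-pos-* : ∀ m n → ι (+ (m ℕ.* n)) ≡ ι (+ m) ℚ.* ι (+ n)
ι-pos-* m n = trans (cong ι (ℤP.pos-* m n)) (ι-* (+ m) (+ n))

ι-↥ : ∀ x → ι (↥ x) ≡ ι (↧ x) ℚ.* x
ι-↥ x = sym (trans (cong (ι (↧ x) ℚ.*_) (sym (ℚP.↥p/↧p≡p x))) (ι-/ (↥ x) (↧ₙ x)))

ℚ-zero-product : ∀ {x y} → x ℚ.* y ≡ 0ℚ → x ≡ 0ℚ ⊎ y ≡ 0ℚ
ℚ-zero-product {x} {y} xy≡0 with x ℚP.≟ 0ℚ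
... | yes x≡0 = inj₁ x≡0
... | no  x≢0 = inj₂ (begin
  y                       ≡⟨ ℚP.*-identityˡ y ⟨
  1ℚ ℚ.* y                ≡⟨ cong (ℚ._* y) (ℚP.*-inverseˡ x) ⟨
  ℚ.1/ x ℚ.* x ℚ.* y      ≡⟨ ℚP.*-assoc (ℚ.1/ x) x y ⟩
  ℚ.1/ x ℚ.* (x ℚ.* y)    ≡⟨ cong (ℚ.1/ x ℚ.*_) xy≡0 ⟩
  ℚ.1/ x ℚ.* 0ℚ           ≡⟨ ℚP.*-zeroʳ (ℚ.1/ x) ⟩
  0ℚ                      ∎)
  where
  open ≡-Reasoning
  instance
    _ : ℚ.NonZero x
    _ = ℚ.≢-nonZero x≢0

module ℤ[X] = Convolution ℤP.+-*-commutativeRing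

module ℚ[X] where
  open Convolution ℚP.+-*-commutativeRing public
  open Domain (ℚP._≟ 0ℚ) ℚ-zero-product public

module F₃[X] where
  open Convolution +₃-*₃-commutativeRing public
  open Domain (_≟₃ 0₃) (λ {x} {y} → *₃-zero-product x y) public

φ-⋆ : ∀ P Q k → φ ((P ℤ[X].⋆ Q) k) ≡ (φ ∘ P F₃[X].⋆ φ ∘ Q) k
φ-⋆ = ⋆-Homomorphism.⋆-homo ℤP.+-*-commutativeRing +₃-*₃-commutativeRing φ φ-+ φ-*

ι-⋆ : ∀ P Q k → ι ((P ℤ[X].⋆ Q) k) ≡ (ι ∘ P ℚ[X].⋆ ι ∘ Q) k
ι-⋆ = ⋆-Homomorphism.⋆-homo ℤP.+-*-commutativeRing ℚP.+-*-commutativeRing ι ι-+ ι-*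

-- Polynomials over ℚ as coefficient lists

coeff-vanishes : ∀ p i → length p ℕ.≤ i → coeff p i ≡ 0ℚ
coeff-vanishes []      i       _         = refl
coeff-vanishes (a ∷ p) (suc i) (s≤s p≤i) = coeff-vanishes p i p≤i

coeff-degree≤ : ∀ p → coeff p ℚ[X].HasDegree≤ length p
coeff-degree≤ p i p<i = coeff-vanishes p i (ℕP.<⇒≤ p<i)

coeff-+P : ∀ p q k → coeff (p +P q) k ≡ coeff p k ℚ.+ coeff q k
coeff-+P []      q       k       = sym (ℚP.+-identityˡ _)
coeff-+P (a ∷ p) []      k       = sym (ℚP.+-identityʳ _)
coeff-+P (a ∷ p) (b ∷ q) zero    = refl
coeff-+P (a ∷ p) (b ∷ q) (suc k) = coeff-+P p q k

coeff-map-* : ∀ a q k → coeff (map (a ℚ.*_) q) k ≡ a ℚ.* coeff q k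
coeff-map-* a []      k       = sym (ℚP.*-zeroʳ a)
coeff-map-* a (b ∷ q) zero    = refl
coeff-map-* a (b ∷ q) (suc k) = coeff-map-* a q k

coeff-*P : ∀ p q k → coeff (p *P q) k ≡ (coeff p ℚ[X].⋆ coeff q) k
coeff-*P []      q k       = sym (ℚ[X].⋆-zeroˡ (coeff q) (λ _ → refl) k)
coeff-*P (a ∷ p) q zero    = begin
  coeff (map (a ℚ.*_) q +P (0ℚ ∷ p *P q)) 0   ≡⟨ coeff-+P (map (a ℚ.*_) q) _ 0 ⟩
  coeff (map (a ℚ.*_) q) 0 ℚ.+ 0ℚ             ≡⟨ ℚP.+-identityʳ _ ⟩
  coeff (map (a ℚ.*_) q) 0                    ≡⟨ coeff-map-* a q 0 ⟩
  a ℚ.* coeff q 0                             ∎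
  where open ≡-Reasoning
coeff-*P (a ∷ p) q (suc k) = trans (coeff-+P (map (a ℚ.*_) q) _ (suc k))
  (cong₂ ℚ._+_ (coeff-map-* a q (suc k)) (coeff-*P p q k))

constant-unit : ∀ g → coeff g ℚ[X].HasDegree 0 → IsUnit g
constant-unit g (g₀≢0 , g≤0) = g₀⁻¹ ∷ [] , λ k →
  trans (coeff-*P g _ k) (trans (ℚ[X].⋆-constˡ _ g≤0 k) (g₀*g₀⁻¹ k))
  where
  instance
    _ : ℚ.NonZero (coeff g 0)
    _ = ℚ.≢-nonZero g₀≢0
  g₀⁻¹ = ℚ.1/ coeff g 0
  g₀*g₀⁻¹ : ∀ k → coeff g 0 ℚ.* coeff (g₀⁻¹ ∷ []) k ≡ coeff oneP k
  g₀*g₀⁻¹ zero    = ℚP.*-inverseʳ (coeff g 0)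
  g₀*g₀⁻¹ (suc k) = ℚP.*-zeroʳ (coeff g 0)

clear-denominators : ∀ p → Σ ℕ λ a → Σ (ℕ → ℤ) λ P → ∀ i → ι (P i) ≡ ι (+ suc a) ℚ.* coeff p i
clear-denominators []      = 0 , (λ _ → + 0) , λ _ → sym (ℚP.*-zeroʳ (ι (+ 1)))
clear-denominators (x ∷ p) with clear-denominators p
-- the new common denominator is ↧ x · (1 + a), the successor of the first component
... | a , P , ιP≡αp = a ℕ.+ ℚ.ℚ.denominator-1 x ℕ.* suc a , P′ , ιP′≡α′p
  where
  P′ : ℕ → ℤ
  P′ zero    = ↥ x ℤ.* + suc a
  P′ (suc i) = ↧ x ℤ.* P i
  ιP′≡α′p : ∀ i → ι (P′ i) ≡ ι (+ (↧ₙ x ℕ.* suc a)) ℚ.* coeff (x ∷ p) i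
  ιP′≡α′p zero    = begin
    ι (↥ x ℤ.* + suc a)                ≡⟨ ι-* (↥ x) (+ suc a) ⟩
    ι (↥ x) ℚ.* ι (+ suc a)            ≡⟨ cong (ℚ._* ι (+ suc a)) (ι-↥ x) ⟩
    ι (↧ x) ℚ.* x ℚ.* ι (+ suc a)      ≡⟨ ℚ*.xy∙z≈xz∙y (ι (↧ x)) x (ι (+ suc a)) ⟩
    ι (↧ x) ℚ.* ι (+ suc a) ℚ.* x      ≡⟨ cong (ℚ._* x) (ι-pos-* (↧ₙ x) (suc a)) ⟨
    ι (+ (↧ₙ x ℕ.* suc a)) ℚ.* x       ∎
    where open ≡-Reasoning
  ιP′≡α′p (suc i) = begin
    ι (↧ x ℤ.* P i)                            ≡⟨ ι-* (↧ x) (P i) ⟩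
    ι (↧ x) ℚ.* ι (P i)                        ≡⟨ cong (ι (↧ x) ℚ.*_) (ιP≡αp i) ⟩
    ι (↧ x) ℚ.* (ι (+ suc a) ℚ.* coeff p i)    ≡⟨ ℚP.*-assoc (ι (↧ x)) _ _ ⟨
    ι (↧ x) ℚ.* ι (+ suc a) ℚ.* coeff p i      ≡⟨ cong (ℚ._* coeff p i) (ι-pos-* (↧ₙ x) (suc a)) ⟨
    ι (+ (↧ₙ x ℕ.* suc a)) ℚ.* coeff p i       ∎
    where open ≡-Reasoning

scaled-⋆ : ∀ α β {P Q a b} → (∀ i → ι (P i) ≡ ι α ℚ.* a i) → (∀ j → ι (Q j) ≡ ι β ℚ.* b j) →
           ∀ k → ι ((P ℤ[X].⋆ Q) k) ≡ ι (α ℤ.* β) ℚ.* (a ℚ[X].⋆ b) k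
scaled-⋆ α β {P} {Q} {a} {b} ιP≡αa ιQ≡βb k = begin
  ι ((P ℤ[X].⋆ Q) k)
    ≡⟨ ι-⋆ P Q k ⟩
  (ι ∘ P ℚ[X].⋆ ι ∘ Q) k
    ≡⟨ ℚ[X].⋆-cong ιP≡αa ιQ≡βb k ⟩
  ((λ i → ι α ℚ.* a i) ℚ[X].⋆ (λ j → ι β ℚ.* b j)) k
    ≡⟨ ℚ[X].⋆-scaleˡ (ι α) a _ k ⟩
  ι α ℚ.* (a ℚ[X].⋆ (λ j → ι β ℚ.* b j)) k
    ≡⟨ cong (ι α ℚ.*_) (ℚ[X].⋆-scaleʳ (ι β) a b k) ⟩
  ι α ℚ.* (ι β ℚ.* (a ℚ[X].⋆ b) k)
    ≡⟨ ℚP.*-assoc (ι α) (ι β) _ ⟨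
  ι α ℚ.* ι β ℚ.* (a ℚ[X].⋆ b) k
    ≡⟨ cong (ℚ._* (a ℚ[X].⋆ b) k) (ι-* α β) ⟨
  ι (α ℤ.* β) ℚ.* (a ℚ[X].⋆ b) k
    ∎
  where open ≡-Reasoning

integral-degree≤ : ∀ α {P a m} → (∀ i → ι (P i) ≡ ι α ℚ.* a i) →
                   a ℚ[X].HasDegree≤ m → P ℤ[X].HasDegree≤ m
integral-degree≤ α ιP≡αa a≤m i m<i =
  ι-injective (trans (ιP≡αa i) (trans (cong (ι α ℚ.*_) (a≤m i m<i)) (ℚP.*-zeroʳ (ι α))))

-- Descent modulo 3

∣i∣<∣3i∣ : ∀ {i} → i ≢ + 0 → ℤ.∣ i ∣ ℕ.< ℤ.∣ + 3 ℤ.* i ∣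
∣i∣<∣3i∣ {i} i≢0 = subst (ℤ.∣ i ∣ ℕ.<_) (trans (ℕP.*-comm ℤ.∣ i ∣ 3) (sym (ℤP.abs-* (+ 3) i)))
  (ℕP.m<m*n ℤ.∣ i ∣ 3 {{ℕ.≢-nonZero (i≢0 ∘ ℤP.∣i∣≡0⇒i≡0)}} (s≤s (s≤s z≤n)))

divide-by-3 : ∀ {R r} → R ℤ[X].HasDegree≤ r → (∀ i → φ (R i) ≡ 0₃) →
              Σ (ℕ → ℤ) λ R′ → R′ ℤ[X].HasDegree≤ r × (∀ i → R i ≡ + 3 ℤ.* R′ i)
divide-by-3 {R} R≤r R̄≡0 = R′ , R′≤r , R≡3R′
  where
  R′ : ℕ → ℤ
  R′ i = proj₁ (φ-kernel (R i) (R̄≡0 i))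
  R≡3R′ : ∀ i → R i ≡ + 3 ℤ.* R′ i
  R≡3R′ i = proj₂ (φ-kernel (R i) (R̄≡0 i))
  R′≤r : R′ ℤ[X].HasDegree≤ _
  R′≤r i r<i = ℤP.*-cancelˡ-≡ (+ 3) (R′ i) (+ 0)
    (trans (sym (R≡3R′ i)) (trans (R≤r i r<i) (sym (ℤP.*-zeroʳ (+ 3)))))

module IntegerDescent
  (D : ℤ) (F : ℕ → ℤ) (m n : ℕ) (F-leading : F (m ℕ.+ n) ≡ D) (φD≡1 : φ D ≡ 1₃)
  (irreducible₃ : ∀ u v → u F₃[X].HasDegree≤ m → v F₃[X].HasDegree≤ n →
                  ¬ (∀ k → φ (F k) ≡ (u F₃[X].⋆ v) k))
  where

  -- As F / D is monic of degree m + n, the equation says P ⋆ Q = M · (F / D).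
  record Factorisation (M : ℤ) : Set where
    field
      P Q       : ℕ → ℤ
      P-degree≤ : P ℤ[X].HasDegree≤ m
      Q-degree≤ : Q ℤ[X].HasDegree≤ n
      equation  : ∀ k → D ℤ.* (P ℤ[X].⋆ Q) k ≡ M ℤ.* F k

  instance
    D-nonZero : ℤ.NonZero D
    D-nonZero = ℤ.≢-nonZero {D} λ D≡0 → 1₃≢0₃ (trans (sym φD≡1) (cong φ D≡0))
      where
      1₃≢0₃ : 1₃ ≢ 0₃
      1₃≢0₃ ()

  divide-out : ∀ {M} P Q → P ℤ[X].HasDegree≤ m → Q ℤ[X].HasDegree≤ n →
               (∀ k → D ℤ.* (+ 3 ℤ.* (P ℤ[X].⋆ Q) k) ≡ M ℤ.* F k) →
               Σ ℤ λ M′ → M ≡ + 3 ℤ.* M′ × Factorisation M′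
  divide-out {M} P Q P≤m Q≤n eq = c t , M≡3cₜ , record
    { P = P ; Q = Q ; P-degree≤ = P≤m ; Q-degree≤ = Q≤n
    ; equation = λ k → ℤP.*-cancelˡ-≡ (+ 3) _ _ (begin
        + 3 ℤ.* (D ℤ.* c k)       ≡⟨ ℤ*.x∙yz≈y∙xz (+ 3) D (c k) ⟩
        D ℤ.* (+ 3 ℤ.* c k)       ≡⟨ eq k ⟩
        M ℤ.* F k                 ≡⟨ cong (ℤ._* F k) M≡3cₜ ⟩
        + 3 ℤ.* c t ℤ.* F k       ≡⟨ ℤP.*-assoc (+ 3) (c t) (F k) ⟩
        + 3 ℤ.* (c t ℤ.* F k)     ∎)
    }
    where
    open ≡-Reasoning
    t = m ℕ.+ n
    c = P ℤ[X].⋆ Q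
    M≡3cₜ : M ≡ + 3 ℤ.* c t
    M≡3cₜ = ℤP.*-cancelʳ-≡ M (+ 3 ℤ.* c t) D (begin
      M ℤ.* D               ≡⟨ cong (M ℤ.*_) F-leading ⟨
      M ℤ.* F t             ≡⟨ eq t ⟨
      D ℤ.* (+ 3 ℤ.* c t)   ≡⟨ ℤP.*-comm D _ ⟩
      + 3 ℤ.* c t ℤ.* D     ∎)

  module _ {M} (fac : Factorisation M) where
    open Factorisation fac

    reduction : ∀ k → (φ ∘ P F₃[X].⋆ φ ∘ Q) k ≡ φ M *₃ φ (F k)
    reduction k = begin
      (φ ∘ P F₃[X].⋆ φ ∘ Q) k          ≡⟨ φ-⋆ P Q k ⟨
      φ ((P ℤ[X].⋆ Q) k)               ≡⟨ cong (_*₃ φ ((P ℤ[X].⋆ Q) k)) φD≡1 ⟨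
      φ D *₃ φ ((P ℤ[X].⋆ Q) k)        ≡⟨ φ-* D _ ⟨
      φ (D ℤ.* (P ℤ[X].⋆ Q) k)         ≡⟨ cong φ (equation k) ⟩
      φ (M ℤ.* F k)                    ≡⟨ φ-* M (F k) ⟩
      φ M *₃ φ (F k)                   ∎
      where open ≡-Reasoning

    coprime-case : φ M ≢ 0₃ → ⊥
    coprime-case φM≢0 = irreducible₃ (λ i → φ M *₃ φ (P i)) (φ ∘ Q)
      (λ i m<i → trans (cong (λ x → φ M *₃ φ x) (P-degree≤ i m<i)) (*₃-zeroʳ (φ M)))
      (λ j n<j → cong φ (Q-degree≤ j n<j))
      λ k → begin
        φ (F k)                                       ≡⟨ x*[x*y]≡y (φ M) (φ (F k)) φM≢0 ⟨
        φ M *₃ (φ M *₃ φ (F k))                       ≡⟨ cong (φ M *₃_) (reduction k) ⟨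
        φ M *₃ (φ ∘ P F₃[X].⋆ φ ∘ Q) k                ≡⟨ F₃[X].⋆-scaleˡ (φ M) (φ ∘ P) (φ ∘ Q) k ⟨
        ((λ i → φ M *₃ φ (P i)) F₃[X].⋆ φ ∘ Q) k      ∎
      where
      open ≡-Reasoning
      x*[x*y]≡y : ∀ x y → x ≢ 0₃ → x *₃ (x *₃ y) ≡ y
      x*[x*y]≡y = from-yes (all₃? λ x → all₃? λ y → ¬? (x ≟₃ 0₃) →-dec (x *₃ (x *₃ y) ≟₃ y))

    divisible-case : φ M ≡ 0₃ → Σ ℤ λ M′ → M ≡ + 3 ℤ.* M′ × Factorisation M′
    divisible-case φM≡0 with F₃[X].⋆-zero-product m n
      (λ i m<i → cong φ (P-degree≤ i m<i)) (λ j n<j → cong φ (Q-degree≤ j n<j))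
      (λ k → trans (reduction k) (cong (_*₃ φ (F k)) φM≡0))
    ... | inj₁ P̄≡0 = let P′ , P′≤m , P≡3P′ = divide-by-3 P-degree≤ P̄≡0 in
      divide-out P′ Q P′≤m Q-degree≤ λ k → trans
        (cong (D ℤ.*_) (sym (trans (ℤ[X].⋆-cong P≡3P′ (λ _ → refl) k)
                                   (ℤ[X].⋆-scaleˡ (+ 3) P′ Q k))))
        (equation k)
    ... | inj₂ Q̄≡0 = let Q′ , Q′≤n , Q≡3Q′ = divide-by-3 Q-degree≤ Q̄≡0 in
      divide-out P Q′ P-degree≤ Q′≤n λ k → trans
        (cong (D ℤ.*_) (sym (trans (ℤ[X].⋆-cong (λ _ → refl) Q≡3Q′ k)
                                   (ℤ[X].⋆-scaleʳ (+ 3) P Q′ k))))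
        (equation k)

  descent : ∀ {M} → Acc ℕ._<_ ℤ.∣ M ∣ → M ≢ + 0 → ¬ Factorisation M
  descent {M} (acc smaller) M≢0 fac with φ M ≟₃ 0₃
  ... | no  φM≢0 = coprime-case fac φM≢0
  ... | yes φM≡0 with divisible-case fac φM≡0
  ...   | M′ , M≡3M′ , fac′ =
    descent (smaller (subst (ℤ.∣ M′ ∣ ℕ.<_) (cong ℤ.∣_∣ (sym M≡3M′)) (∣i∣<∣3i∣ M′≢0))) M′≢0 fac′
    where
    M′≢0 : M′ ≢ + 0
    M′≢0 M′≡0 = M≢0 (trans M≡3M′ (trans (cong (+ 3 ℤ.*_) M′≡0) (ℤP.*-zeroʳ (+ 3))))

  no-factorisation : ∀ {M} → M ≢ + 0 → ¬ Factorisation M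
  no-factorisation = descent (<-wellFounded _)

-- The polynomial f_z

-- Integer polynomial expressions in z, evaluated in ℤ and in F₃.  The numerators of the
-- coefficients of f z are written below exactly as in Defs, so that evalℤ recovers them
-- definitionally.
infixl 6 _⊕_ _⊝_
infixl 7 _⊗_
infixr 8 _↑_

data Expr : Set where
  X   : Expr
  K   : ℕ → Expr
  _⊕_ _⊝_ _⊗_ : Expr → Expr → Expr
  ⊖_  : Expr → Expr
  _↑_ : Expr → ℕ → Expr

evalℤ : Expr → ℤ → ℤ
evalℤ X       z = z
evalℤ (K n)   z = + n
evalℤ (a ⊕ b) z = evalℤ a z ℤ.+ evalℤ b z
evalℤ (a ⊝ b) z = evalℤ a z ℤ.- evalℤ b z
evalℤ (a ⊗ b) z = evalℤ a z ℤ.* evalℤ b z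
evalℤ (⊖ a)   z = ℤ.- evalℤ a z
evalℤ (a ↑ n) z = evalℤ a z ℤ.^ n

eval₃ : Expr → F₃ → F₃
eval₃ X       z = z
eval₃ (K n)   z = φℕ n
eval₃ (a ⊕ b) z = eval₃ a z +₃ eval₃ b z
eval₃ (a ⊝ b) z = eval₃ a z +₃ -₃ eval₃ b z
eval₃ (a ⊗ b) z = eval₃ a z *₃ eval₃ b z
eval₃ (⊖ a)   z = -₃ eval₃ a z
eval₃ (a ↑ n) z = eval₃ a z ^₃ n

φ-eval : ∀ e z → φ (evalℤ e z) ≡ eval₃ e (φ z)
φ-eval X       z = refl
φ-eval (K n)   z = refl
φ-eval (a ⊕ b) z = trans (φ-+ (evalℤ a z) _) (cong₂ _+₃_ (φ-eval a z) (φ-eval b z))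
φ-eval (a ⊝ b) z = trans (φ-+ (evalℤ a z) _)
  (cong₂ _+₃_ (φ-eval a z) (trans (φ-neg (evalℤ b z)) (cong -₃_ (φ-eval b z))))
φ-eval (a ⊗ b) z = trans (φ-* (evalℤ a z) _) (cong₂ _*₃_ (φ-eval a z) (φ-eval b z))
φ-eval (⊖ a)   z = trans (φ-neg (evalℤ a z)) (cong -₃_ (φ-eval a z))
φ-eval (a ↑ n) z = trans (φ-^ (evalℤ a z) n) (cong (_^₃ n) (φ-eval a z))

E₀ E₁ E₂ : Expr
E₂ = K 3 ⊗ X ↑ 6 ⊝ K 16 ⊗ X ↑ 4 ⊕ K 37 ⊗ X ↑ 2 ⊝ K 32
E₁ = K 2 ⊗ X ↑ 9 ⊝ K 19 ⊗ X ↑ 7 ⊕ K 72 ⊗ X ↑ 5 ⊝ K 135 ⊗ X ↑ 3 ⊕ K 96 ⊗ X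
E₀ = K 3 ⊗ X ↑ 12 ⊝ K 40 ⊗ X ↑ 10 ⊕ K 214 ⊗ X ↑ 8 ⊝ K 576 ⊗ X ↑ 6
       ⊕ K 719 ⊗ X ↑ 4 ⊝ K 64 ⊗ X ↑ 2 ⊝ K 512

-- The coefficients of F z = 256 · f z, an integer polynomial with leading coefficient 256.
F-coeff : ℕ → Expr
F-coeff 0 = ⊖ (K 1 ⊗ E₀)
F-coeff 1 = ⊖ (K 16 ⊗ E₁)
F-coeff 2 = ⊖ (K 32 ⊗ E₂)
F-coeff 3 = ⊖ (K 256 ⊗ X)
F-coeff 4 = K 256
F-coeff _ = K 0

F : ℤ → ℕ → ℤ
F z k = evalℤ (F-coeff k) z

F₃-coeff : F₃ → ℕ → F₃
F₃-coeff z̄ k = eval₃ (F-coeff k) z̄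

coeffᵥ : ∀ {n} → Vec F₃ n → ℕ → F₃
coeffᵥ []       _       = 0₃
coeffᵥ (x ∷ xs) zero    = x
coeffᵥ (x ∷ xs) (suc i) = coeffᵥ xs i

allVec? : ∀ n {p} {P : Vec F₃ n → Set p} → Decidable P → Dec (∀ v → P v)
allVec? zero    P? = map′ (λ p → λ { [] → p }) (λ ∀P → ∀P []) (P? [])
allVec? (suc n) P? = map′ (λ ∀P → λ { (x ∷ v) → ∀P x v }) (λ ∀P x v → ∀P (x ∷ v))
                          (all₃? λ x → allVec? n λ v → P? (x ∷ v))

NoFactorisation₃ : ℕ → ℕ → Set
NoFactorisation₃ m n = ∀ z̄ (u : Vec F₃ (suc m)) (v : Vec F₃ (suc n)) →
  ¬ (∀ (k : Fin 5) → F₃-coeff z̄ (toℕ k) ≡ (coeffᵥ u F₃[X].⋆ coeffᵥ v) (toℕ k))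

noFactorisation₃? : ∀ m n → Dec (NoFactorisation₃ m n)
noFactorisation₃? m n = all₃? λ z̄ → allVec? (suc m) λ u → allVec? (suc n) λ v →
  ¬? (all? λ k → F₃-coeff z̄ (toℕ k) ≟₃ (coeffᵥ u F₃[X].⋆ coeffᵥ v) (toℕ k))

no-factorisation₃ : ∀ d e → d ℕ.+ e ≡ 2 → NoFactorisation₃ (suc d) (suc e)
no-factorisation₃ 0 _ refl = from-yes (noFactorisation₃? 1 3)
no-factorisation₃ 1 _ refl = from-yes (noFactorisation₃? 2 2)
no-factorisation₃ 2 _ refl = from-yes (noFactorisation₃? 3 1)
no-factorisation₃ (suc (suc (suc _))) _ ()

truncate : ∀ m → (ℕ → F₃) → Vec F₃ (suc m)
truncate m u = tabulate (u ∘ toℕ)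

coeffᵥ-truncate : ∀ m {u} → u F₃[X].HasDegree≤ m → ∀ i → coeffᵥ (truncate m u) i ≡ u i
coeffᵥ-truncate zero    u≤0 zero    = refl
coeffᵥ-truncate zero    u≤0 (suc i) = sym (u≤0 (suc i) (s≤s z≤n))
coeffᵥ-truncate (suc m) u≤m zero    = refl
coeffᵥ-truncate (suc m) u≤m (suc i) = coeffᵥ-truncate m (λ j → u≤m (suc j) ∘ s≤s) i

F-irreducible-mod-3 : ∀ z d e → suc d ℕ.+ suc e ≡ 4 →
  ∀ u v → u F₃[X].HasDegree≤ suc d → v F₃[X].HasDegree≤ suc e →
  ¬ (∀ k → φ (F z k) ≡ (u F₃[X].⋆ v) k)
F-irreducible-mod-3 z d e 2+d+e≡4 u v u≤ v≤ F̄≡uv =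
  no-factorisation₃ d e d+e≡2 (φ z) (truncate _ u) (truncate _ v) λ k → begin
    F₃-coeff (φ z) (toℕ k)
      ≡⟨ φ-eval (F-coeff (toℕ k)) z ⟨
    φ (F z (toℕ k))
      ≡⟨ F̄≡uv (toℕ k) ⟩
    (u F₃[X].⋆ v) (toℕ k)
      ≡⟨ F₃[X].⋆-cong (coeffᵥ-truncate _ u≤) (coeffᵥ-truncate _ v≤) (toℕ k) ⟨
    (coeffᵥ (truncate _ u) F₃[X].⋆ coeffᵥ (truncate _ v)) (toℕ k)
      ∎
  where
  open ≡-Reasoning
  d+e≡2 : d ℕ.+ e ≡ 2
  d+e≡2 = ℕP.suc-injective (trans (sym (ℕP.+-suc d e)) (ℕP.suc-injective 2+d+e≡4))

ι-neg-scaled : ∀ a e d .{{_ : ℕ.NonZero d}} →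
               ι (ℤ.- (+ e ℤ.* a)) ≡ ι (+ (e ℕ.* d)) ℚ.* ℚ.- (a ℚ./ d)
ι-neg-scaled a e d = begin
  ι (ℤ.- (+ e ℤ.* a))                         ≡⟨ ι-neg (+ e ℤ.* a) ⟩
  ℚ.- ι (+ e ℤ.* a)                           ≡⟨ cong ℚ.-_ (ι-* (+ e) a) ⟩
  ℚ.- (ι (+ e) ℚ.* ι a)                       ≡⟨ cong (λ x → ℚ.- (ι (+ e) ℚ.* x)) (ι-/ a d) ⟨
  ℚ.- (ι (+ e) ℚ.* (ι (+ d) ℚ.* (a ℚ./ d)))   ≡⟨ cong ℚ.-_ (ℚP.*-assoc (ι (+ e)) (ι (+ d)) _) ⟨
  ℚ.- (ι (+ e) ℚ.* ι (+ d) ℚ.* (a ℚ./ d))     ≡⟨ ℚP.neg-distribʳ-* (ι (+ e) ℚ.* ι (+ d)) _ ⟩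
  ι (+ e) ℚ.* ι (+ d) ℚ.* ℚ.- (a ℚ./ d)       ≡⟨ cong (ℚ._* ℚ.- (a ℚ./ d)) (ι-pos-* e d) ⟨
  ι (+ (e ℕ.* d)) ℚ.* ℚ.- (a ℚ./ d)           ∎
  where open ≡-Reasoning

ι-F : ∀ z k → ι (F z k) ≡ ι (+ 256) ℚ.* coeff (f z) k
ι-F z 0 = ι-neg-scaled (evalℤ E₀ z) 1 256
ι-F z 1 = ι-neg-scaled (evalℤ E₁ z) 16 16
ι-F z 2 = ι-neg-scaled (evalℤ E₂ z) 32 8
ι-F z 3 = ι-neg-scaled z 256 1
ι-F z 4 = sym (ℚP.*-identityʳ (ι (+ 256)))
ι-F z (suc (suc (suc (suc (suc k))))) = sym (ℚP.*-zeroʳ (ι (+ 256)))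

cleared-equation : ∀ z α β {P Q g h} →
  (∀ i → ι (P i) ≡ ι α ℚ.* g i) → (∀ j → ι (Q j) ≡ ι β ℚ.* h j) →
  (∀ k → coeff (f z) k ≡ (g ℚ[X].⋆ h) k) →
  ∀ k → + 256 ℤ.* (P ℤ[X].⋆ Q) k ≡ (α ℤ.* β) ℤ.* F z k
cleared-equation z α β {P} {Q} {g} {h} ιP≡αg ιQ≡βh f≡gh k = ι-injective (begin
  ι (+ 256 ℤ.* (P ℤ[X].⋆ Q) k)
    ≡⟨ ι-* (+ 256) ((P ℤ[X].⋆ Q) k) ⟩
  ι (+ 256) ℚ.* ι ((P ℤ[X].⋆ Q) k)
    ≡⟨ cong (ι (+ 256) ℚ.*_) (scaled-⋆ α β ιP≡αg ιQ≡βh k) ⟩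
  ι (+ 256) ℚ.* (ι (α ℤ.* β) ℚ.* (g ℚ[X].⋆ h) k)
    ≡⟨ ℚ*.x∙yz≈y∙xz (ι (+ 256)) (ι (α ℤ.* β)) _ ⟩
  ι (α ℤ.* β) ℚ.* (ι (+ 256) ℚ.* (g ℚ[X].⋆ h) k)
    ≡⟨ cong (λ x → ι (α ℤ.* β) ℚ.* (ι (+ 256) ℚ.* x)) (f≡gh k) ⟨
  ι (α ℤ.* β) ℚ.* (ι (+ 256) ℚ.* coeff (f z) k)
    ≡⟨ cong (ι (α ℤ.* β) ℚ.*_) (ι-F z k) ⟨
  ι (α ℤ.* β) ℚ.* ι (F z k)
    ≡⟨ ι-* (α ℤ.* β) (F z k) ⟨
  ι ((α ℤ.* β) ℤ.* F z k)
    ∎)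
  where open ≡-Reasoning

no-proper-factorisation : ∀ z g h {d e} →
  coeff g ℚ[X].HasDegree suc d → coeff h ℚ[X].HasDegree suc e → suc d ℕ.+ suc e ≡ 4 →
  ¬ (∀ k → coeff (f z) k ≡ (coeff g ℚ[X].⋆ coeff h) k)
no-proper-factorisation z g h {d} {e} (_ , g≤) (_ , h≤) deg≡4 f≡gh =
  let a , P , ιP≡αg = clear-denominators g
      b , Q , ιQ≡βh = clear-denominators h
      open IntegerDescent (+ 256) (F z) (suc d) (suc e) (cong (F z) deg≡4) refl
                          (F-irreducible-mod-3 z d e deg≡4)
  in no-factorisation {+ suc a ℤ.* + suc b} (λ ()) record
    { P         = P
    ; Q         = Q
    ; P-degree≤ = integral-degree≤ (+ suc a) ιP≡αg g≤
    ; Q-degree≤ = integral-degree≤ (+ suc b) ιQ≡βh h≤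
    ; equation  = cleared-equation z (+ suc a) (+ suc b) ιP≡αg ιQ≡βh f≡gh
    }

f-degree : ∀ z → coeff (f z) ℚ[X].HasDegree 4
f-degree z = ℚP.1≢0 , λ i 4<i → coeff-vanishes (f z) i 4<i

f-not-unit : ∀ z → ¬ IsUnit (f z)
f-not-unit z (h , fh≈1) = [ h≉0 , h-has-no-degree ]′ (ℚ[X].degree (length h) (coeff-degree≤ h))
  where
  fh≡1 : ∀ k → (coeff (f z) ℚ[X].⋆ coeff h) k ≡ coeff oneP k
  fh≡1 k = trans (sym (coeff-*P (f z) h k)) (fh≈1 k)
  h≉0 : ¬ (∀ i → coeff h i ≡ 0ℚ)
  h≉0 h≈0 = ℚP.1≢0 (trans (sym (fh≡1 0)) (ℚ[X].⋆-zeroʳ (coeff (f z)) h≈0 0))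
  h-has-no-degree : ¬ ∃ (coeff h ℚ[X].HasDegree_)
  h-has-no-degree (e , h∶e) = ℕP.1+n≢0 (ℚ[X].degree-unique
    (ℚ[X].degree-cong fh≡1 (ℚ[X].⋆-degree (f-degree z) h∶e)) (ℚP.1≢0 , λ { (suc _) _ → refl }))

f-factors-trivially : ∀ z g h → f z ≈P g *P h → IsUnit g ⊎ IsUnit h
f-factors-trivially z g h f≈gh =
  [ inj₁ ∘ constant-unit g
  , [ inj₂ ∘ constant-unit h
    , (λ (_ , _ , g∶d , h∶e , deg≡4) → ⊥-elim (no-proper-factorisation z g h g∶d h∶e deg≡4 f≡gh))
    ]′
  ]′ (ℚ[X].⋆-factor-degrees _ _ (coeff-degree≤ g) (coeff-degree≤ h) (f-degree z) f≡gh)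
  where
  f≡gh : ∀ k → coeff (f z) k ≡ (coeff g ℚ[X].⋆ coeff h) k
  f≡gh k = trans (f≈gh k) (coeff-*P g h k)

lemma3p3 : (z : ℤ) → Irreducible (f z)
lemma3p3 z = (λ f≈0 → proj₁ (f-degree z) (f≈0 4)) , f-not-unit z , f-factors-trivially z
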